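{- Let $G$ be a claw-free graph. Then: (1) if $v$ is a frontier vertex lying in two distinct regions $R,R'$, then $N_R(v)$ and $N_{R'}(v)$ are cliques of $G$; (2) if $R$ is a region of $G$, then $\mathrm{cl}(R)$ is a complete graph; (3) if $v$ is a frontier vertex and $R$ is a region containing $v$, then either $v$ has a neighbor in $R$ that is an interior vertex, or $R$ is complete and has no interior vertices; (4) if $u$ and $v$ are associated, then there is an induced path in $G$ from $u$ to $v$ all of whose internal vertices are interior vertices of the region containing $u$ and $v$.
   Context: All graphs are finite and simple; a graph is claw-free if it has no induced $K_{1,3}$. For a vertex $v$ and subgraph $R$ of $G$, $N_R(v)$ is the set of neighbors of $v$ in $R$. In a claw-free graph $G$, a vertex $x$ is eligible if its neighborhood $N(x)$ induces a connected subgraph that is not complete; the completion of $G$ at $x$ is the graph obtained by adding all missing edges $uv$ with $u,v\in N(x)$. The closure $\mathrm{cl}(G)$ is obtained by repeatedly completing at an eligible vertex until no eligible vertex remains; this is well defined (independent of the order), and the resulting graph is claw-free. For a maximal clique $K$ of $\mathrm{cl}(G)$, the induced subgraph $G[K]$ is called a region of $G$. A vertex of $G$ is an interior vertex if it lies in exactly one region, and a frontier vertex if it lies in two distinct regions (every vertex is one of these). Two vertices $u,v$ are associated if they lie in a common region (equivalently, are adjacent in $\mathrm{cl}(G)$); two distinct regions share at most one vertex, so if $u\ne v$ are associated, the region containing both is unique. A region $R$, being an induced subgraph of a claw-free graph, is claw-free, so $\mathrm{cl}(R)$ is defined. -}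

module Defs where

open import Level using (0ℓ)
open import Data.Nat using (ℕ; zero; suc; _<_)
open import Data.Fin using (Fin; toℕ)
open import Data.Fin.Subset using (Subset; _∈_; _∉_)
open import Data.Product using (Σ; ∃; _×_; _,_)
open import Data.Sum using (_⊎_)
open import Data.Empty using (⊥)
open import Relation.Nullary using (¬_)
open import Relation.Binary.PropositionalEquality using (_≡_; _≢_)

Rel : ℕ → Set₁
Rel n = Fin n → Fin n → Set

module _ {n : ℕ} where

  record SimpleGraph (E : Rel n) : Set where
    field
      sym     : ∀ {u v} → E u v → E v u
      irrefl  : ∀ {u} → ¬ E u u
      decide  : ∀ u v → E u v ⊎ ¬ E u v

  -- All graphs below are considered as the induced subgraph on a vertex set S.

  ClawFree : Subset n → Rel n → Set
  ClawFree S E =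
    ∀ x a b c → x ∈ S → a ∈ S → b ∈ S → c ∈ S →
    E x a → E x b → E x c →
    a ≢ b → a ≢ c → b ≢ c →
    ¬ E a b → ¬ E a c → ¬ E b c → ⊥

  Nbhd : Subset n → Rel n → Fin n → Fin n → Set
  Nbhd S E x u = u ∈ S × E x u

  IsClique : (Fin n → Set) → Rel n → Set
  IsClique P E = ∀ u v → P u → P v → u ≢ v → E u v

  data Walk (P : Fin n → Set) (E : Rel n) : Fin n → Fin n → Set where
    here : ∀ {u} → P u → Walk P E u u
    step : ∀ {u w v} → P u → E u w → Walk P E w v → Walk P E u v

  Connected : (Fin n → Set) → Rel n → Set
  Connected P E = ∀ u v → P u → P v → Walk P E u v

  Eligible : Subset n → Rel n → Fin n → Set
  Eligible S E x = x ∈ S × Connected (Nbhd S E x) E × ¬ IsClique (Nbhd S E x) E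

  completeAt : Subset n → Rel n → Fin n → Rel n
  completeAt S E x u v = E u v ⊎ (u ≢ v × Nbhd S E x u × Nbhd S E x v)

  data CompSeq (S : Subset n) : Rel n → Rel n → Set₁ where
    done : ∀ {E} → CompSeq S E E
    next : ∀ {E E'} x → Eligible S E x → CompSeq S (completeAt S E x) E' → CompSeq S E E'

  IsClosure : Subset n → Rel n → Rel n → Set₁
  IsClosure S E H = CompSeq S E H × (∀ x → ¬ Eligible S H x)

  MaxClique : Rel n → Subset n → Set
  MaxClique H K = IsClique (_∈ K) H × (∀ w → (∀ u → u ∈ K → u ≢ w → H u w) → w ∈ K)

  -- regions of G are G[K] for maximal cliques K of cl(G) = H; we identify a region with K
  Region : Rel n → Subset n → Set
  Region H K = MaxClique H K

  Interior : Rel n → Fin n → Set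
  Interior H v = Σ (Subset n) λ K → Region H K × v ∈ K × (∀ K' → Region H K' → v ∈ K' → K' ≡ K)

  Frontier : Rel n → Fin n → Set
  Frontier H v = Σ (Subset n) λ K → Σ (Subset n) λ K' →
    Region H K × Region H K' × K ≢ K' × v ∈ K × v ∈ K'

  record InducedPath (E : Rel n) (k : ℕ) (p : Fin (suc k) → Fin n) : Set where
    field
      distinct : ∀ i j → p i ≡ p j → i ≡ j
      adj      : ∀ i j → E (p i) (p j) → (toℕ j ≡ suc (toℕ i) ⊎ toℕ i ≡ suc (toℕ j))
      adj'     : ∀ i j → (toℕ j ≡ suc (toℕ i) ⊎ toℕ i ≡ suc (toℕ j)) → E (p i) (p j)

-- Let H = cl(G). An edge of H arises from a completion at a centre x, and if the edge lies in a
-- region K then so does x, because in the closed claw-free graph H a common neighbour of two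
-- vertices of a maximal clique belongs to it. Moreover x becomes simplicial in H, hence interior.
-- Tracing the completions backwards therefore realises every H-edge inside K as a G-walk whose
-- inner vertices are interior vertices of K, which yields (3), and (4) after shortcutting the walk
-- to an induced path. The same tracing shows that an H-edge at v inside K comes from a G-edge at v
-- inside K, so a non-adjacent pair in N_R(v) and a G-neighbour of v in the other region would be
-- the leaves of a claw (1); and that every H-edge inside K is an edge of cl(R), which is therefore
-- complete (2).

module Submission where

open import Defs
open import Data.Nat using (ℕ; suc; _<_)
import Data.Nat.Properties as ℕ
open import Data.Fin using (Fin; toℕ; zero; suc; fromℕ; _≟_)
open import Data.Fin.Properties using (all?; any?; toℕ-fromℕ)
open import Data.Fin.Subset using (Subset; _∈_; ⊤; _⊆_; _∪_; ⁅_⁆)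
open import Data.Fin.Subset.Properties using (∈⊤; _∈?_; ⊆-antisym; x∈p∪q⁺; x∈p∪q⁻; x∈⁅x⁆; x∈⁅y⁆⇒x≡y)
open import Data.List using (List; []; _∷_; length; lookup; allFin)
open import Data.List.Membership.Propositional.Properties using (∈-lookup; ∈-allFin)
open import Data.List.Relation.Unary.All as All using (All; []; _∷_)
open import Data.List.Relation.Unary.All.Properties using (¬Any⇒All¬)
open import Data.List.Relation.Unary.Any as Any using (Any)
open import Data.Product using (Σ; _×_; _,_; proj₁; proj₂)
open import Data.Sum as Sum using (_⊎_; inj₁; inj₂)
open import Data.Empty using (⊥; ⊥-elim)
open import Function using (_∘_)
open import Relation.Binary.Definitions using (Symmetric)
open import Relation.Nullary using (¬_; Dec; yes; no)
open import Relation.Nullary.Decidable using (_×-dec_; _⊎-dec_; _→-dec_; ¬?; fromSum; toSum)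
open import Relation.Binary.PropositionalEquality using (_≡_; _≢_; refl; sym; trans; cong; subst; ≢-sym)

module _ {n : ℕ} where

  private variable
    S : Subset n
    E F : Rel n
    P P′ Q R : Fin n → Set
    u v w x y : Fin n
    ps : List (Fin n)

  walk-head : Walk P E u v → P u
  walk-head (here pu)     = pu
  walk-head (step pu _ _) = pu

  _++ʷ_ : Walk P E u v → Walk P E v w → Walk P E u w
  here _       ++ʷ q = q
  step pu e p ++ʷ q = step pu e (p ++ʷ q)

  reverseʷ : Symmetric E → Walk P E u v → Walk P E v u
  reverseʷ sym-E (here pu)     = here pu
  reverseʷ sym-E (step pu e p) = reverseʷ sym-E p ++ʷ step (walk-head p) (sym-E e) (here pu)

  mapʷ : (∀ {a} → P a → P′ a) → (∀ {a b} → E a b → F a b) → Walk P E u v → Walk P′ F u v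
  mapʷ f g (here pu)     = here (f pu)
  mapʷ f g (step pu e p) = step (f pu) (g e) (mapʷ f g p)

  adjacent? : SimpleGraph E → ∀ u v → Dec (E u v)
  adjacent? g u v = fromSum (SimpleGraph.decide g u v)

  completeAt-simple : SimpleGraph E → SimpleGraph (completeAt S E x)
  completeAt-simple {E = E} {S = S} {x = x} g = record
    { sym    = sym′
    ; irrefl = irrefl′
    ; decide = λ u v → toSum (completeAt? u v)
    }
    where
    sym′ : Symmetric (completeAt S E x)
    sym′ (inj₁ e)               = inj₁ (SimpleGraph.sym g e)
    sym′ (inj₂ (u≢v , xu , xv)) = inj₂ (≢-sym u≢v , xv , xu)

    irrefl′ : ¬ completeAt S E x u u
    irrefl′ (inj₁ e)         = SimpleGraph.irrefl g e
    irrefl′ (inj₂ (u≢u , _)) = u≢u refl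

    completeAt? : ∀ u v → Dec (completeAt S E x u v)
    completeAt? u v = adjacent? g u v ⊎-dec
      (¬? (u ≟ v) ×-dec ((u ∈? S) ×-dec adjacent? g x u) ×-dec ((v ∈? S) ×-dec adjacent? g x v))

  completeAt-clawFree : x ∈ S → SimpleGraph E → ClawFree S E → ClawFree S (completeAt S E x)
  completeAt-clawFree {x = x} {S = S} {E = E} xS g clawFree c a b d cS aS bS dS = claw
    where
    E′ = completeAt S E x
    sym′ = SimpleGraph.sym (completeAt-simple {S = S} {x = x} g)

    -- A claw of E′ in which the edge c p is new: then x, q, r would be a claw of E at c.
    newLeaf : ∀ {p q r} → q ∈ S → r ∈ S → Nbhd S E x c → Nbhd S E x p →
              E′ c q → E′ c r → p ≢ q → p ≢ r → q ≢ r → ¬ E′ p q → ¬ E′ p r → ¬ E′ q r → ⊥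
    newLeaf {p} {q} {r} qS rS (_ , xc) xp cq cr p≢q p≢r q≢r ¬pq ¬pr ¬qr =
      clawFree c x q r cS xS qS rS (SimpleGraph.sym g xc) (old cq p≢q ¬pq) (old cr p≢r ¬pr)
        (x≢ ¬pq) (x≢ ¬pr) q≢r (¬x p≢q ¬pq qS) (¬x p≢r ¬pr rS) (¬qr ∘ inj₁)
      where
      old : ∀ {t} → E′ c t → p ≢ t → ¬ E′ p t → E c t
      old (inj₁ e)              _   _   = e
      old (inj₂ (_ , _ , xt))   p≢t ¬pt = ⊥-elim (¬pt (inj₂ (p≢t , xp , xt)))
      x≢ : ∀ {t} → ¬ E′ p t → x ≢ t
      x≢ ¬pt refl = ¬pt (inj₁ (SimpleGraph.sym g (proj₂ xp)))
      ¬x : ∀ {t} → p ≢ t → ¬ E′ p t → t ∈ S → ¬ E x t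
      ¬x p≢t ¬pt tS xt = ¬pt (inj₂ (p≢t , xp , (tS , xt)))

    claw : E′ c a → E′ c b → E′ c d → a ≢ b → a ≢ d → b ≢ d → ¬ E′ a b → ¬ E′ a d → ¬ E′ b d → ⊥
    claw (inj₂ (_ , xc , xa)) cb cd a≢b a≢d b≢d ¬ab ¬ad ¬bd =
      newLeaf bS dS xc xa cb cd a≢b a≢d b≢d ¬ab ¬ad ¬bd
    claw ca (inj₂ (_ , xc , xb)) cd a≢b a≢d b≢d ¬ab ¬ad ¬bd =
      newLeaf aS dS xc xb ca cd (≢-sym a≢b) b≢d a≢d (¬ab ∘ sym′) ¬bd ¬ad
    claw ca cb (inj₂ (_ , xc , xd)) a≢b a≢d b≢d ¬ab ¬ad ¬bd =
      newLeaf aS bS xc xd ca cb (≢-sym a≢d) (≢-sym b≢d) a≢b (¬ad ∘ sym′) (¬bd ∘ sym′) ¬ab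
    claw (inj₁ ca) (inj₁ cb) (inj₁ cd) a≢b a≢d b≢d ¬ab ¬ad ¬bd =
      clawFree c a b d cS aS bS dS ca cb cd a≢b a≢d b≢d (¬ab ∘ inj₁) (¬ad ∘ inj₁) (¬bd ∘ inj₁)

  completeAt-connectedNbhd : y ∈ S → SimpleGraph F →
    Connected (Nbhd S F x) F → Connected (Nbhd S (completeAt S F y) x) (completeAt S F y)
  completeAt-connectedNbhd {y = y} {S = S} {F = F} {x = x} yS g connected a b xa xb =
    toOld xa ++ʷ (mapʷ lift inj₁ (connected _ _ (oldNbhd xa) (oldNbhd xb)) ++ʷ
                  reverseʷ (SimpleGraph.sym (completeAt-simple g)) (toOld xb))
    where
    F′ = completeAt S F y
    lift : Nbhd S F x u → Nbhd S F′ x u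
    lift (uS , xu) = uS , inj₁ xu

    -- a new neighbour of x is an old neighbour of y, and y is an old neighbour of x
    anchor : Nbhd S F′ x u → Fin n
    anchor {u} (_ , inj₁ _) = u
    anchor     (_ , inj₂ _) = y

    oldNbhd : (xu : Nbhd S F′ x u) → Nbhd S F x (anchor xu)
    oldNbhd (uS , inj₁ xu)                 = uS , xu
    oldNbhd (_  , inj₂ (_ , (_ , yx) , _)) = yS , SimpleGraph.sym g yx

    toOld : (xu : Nbhd S F′ x u) → Walk (Nbhd S F′ x) F′ u (anchor xu)
    toOld xu@(_  , inj₁ _)                  = here xu
    toOld xu@(_  , inj₂ (_ , _ , (_ , yu))) =
      step xu (inj₁ (SimpleGraph.sym g yu)) (here (lift (oldNbhd xu)))

  compSeq-simple : SimpleGraph E → CompSeq S E F → SimpleGraph F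
  compSeq-simple g done          = g
  compSeq-simple g (next x _ cs) = compSeq-simple (completeAt-simple g) cs

  compSeq-mono : CompSeq S E F → E u v → F u v
  compSeq-mono done          e = e
  compSeq-mono (next x _ cs) e = compSeq-mono cs (inj₁ e)

  compSeq-clawFree : SimpleGraph E → ClawFree S E → CompSeq S E F → ClawFree S F
  compSeq-clawFree g clawFree done = clawFree
  compSeq-clawFree g clawFree (next x (xS , _) cs) =
    compSeq-clawFree (completeAt-simple g) (completeAt-clawFree xS g clawFree) cs

  compSeq-connectedNbhd : SimpleGraph E → CompSeq S E F →
    Connected (Nbhd S E x) E → Connected (Nbhd S F x) F
  compSeq-connectedNbhd g done                 connected = connected
  compSeq-connectedNbhd g (next y (yS , _) cs) connected =
    compSeq-connectedNbhd (completeAt-simple g) cs (completeAt-connectedNbhd yS g connected)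

  Closed : Subset n → Rel n → Set
  Closed S E = ∀ x → ¬ Eligible S E x

  -- If u and w were non-adjacent, claw-freeness would put every other neighbour of y next to
  -- one of them, so the walk would make N(y) connected and y eligible.
  closed-walk⇒adjacent : SimpleGraph E → ClawFree S E → Closed S E → y ∈ S →
    Nbhd S E y u → Nbhd S E y w → u ≢ w → Walk (Nbhd S E y) E u w → E u w
  closed-walk⇒adjacent {E = E} {S = S} {y = y} {u = u} {w = w} g clawFree closed yS yu yw u≢w p
    with adjacent? g u w
  ... | yes uw = uw
  ... | no ¬uw = ⊥-elim (closed y (yS , connected , λ clique → ¬uw (clique u w yu yw u≢w)))
    where
    N = Nbhd S E y
    sym-E = SimpleGraph.sym g

    toU : ∀ z → N z → Walk N E z u
    toU z yz with z ≟ u | z ≟ w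
    ... | yes refl | _        = here yz
    ... | no _     | yes refl = reverseʷ sym-E p
    ... | no z≢u   | no z≢w with adjacent? g z u | adjacent? g z w
    ...   | yes zu | _      = step yz zu (here yu)
    ...   | no _   | yes zw = step yz zw (reverseʷ sym-E p)
    ...   | no ¬zu | no ¬zw = ⊥-elim (clawFree y u w z yS (proj₁ yu) (proj₁ yw) (proj₁ yz)
            (proj₂ yu) (proj₂ yw) (proj₂ yz) u≢w (≢-sym z≢u) (≢-sym z≢w)
            ¬uw (¬zu ∘ sym-E) (¬zw ∘ sym-E))

    connected : Connected N E
    connected a b ya yb = toU a ya ++ʷ reverseʷ sym-E (toU b yb)

  module _ (g : SimpleGraph E) where

    AdjacentToAll : Subset n → Fin n → Set
    AdjacentToAll C w = ∀ z → z ∈ C → z ≢ w → E z w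

    adjacentToAll? : ∀ C w → Dec (AdjacentToAll C w)
    adjacentToAll? C w = all? λ z → (z ∈? C) →-dec (¬? (z ≟ w) →-dec adjacent? g z w)

    insert-clique : ∀ {C} → IsClique (_∈ C) E → AdjacentToAll C w → IsClique (_∈ C ∪ ⁅ w ⁆) E
    insert-clique {w = w} {C = C} clique adj a b a∈ b∈ a≢b with x∈p∪q⁻ C ⁅ w ⁆ a∈ | x∈p∪q⁻ C ⁅ w ⁆ b∈
    ... | inj₁ aC | inj₁ bC = clique a b aC bC a≢b
    ... | inj₁ aC | inj₂ bw rewrite x∈⁅y⁆⇒x≡y w bw = adj a aC a≢b
    ... | inj₂ aw | inj₁ bC rewrite x∈⁅y⁆⇒x≡y w aw = SimpleGraph.sym g (adj b bC (≢-sym a≢b))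
    ... | inj₂ aw | inj₂ bw = ⊥-elim (a≢b (trans (x∈⁅y⁆⇒x≡y w aw) (sym (x∈⁅y⁆⇒x≡y w bw))))

    grow : Subset n → List (Fin n) → Subset n
    grow C []       = C
    grow C (w ∷ ws) with adjacentToAll? C w
    ... | yes _ = grow (C ∪ ⁅ w ⁆) ws
    ... | no  _ = grow C ws

    grow-⊇ : ∀ C ws → C ⊆ grow C ws
    grow-⊇ C []       = λ x∈ → x∈
    grow-⊇ C (w ∷ ws) with adjacentToAll? C w
    ... | yes _ = grow-⊇ (C ∪ ⁅ w ⁆) ws ∘ x∈p∪q⁺ ∘ inj₁
    ... | no  _ = grow-⊇ C ws

    grow-clique : ∀ C ws → IsClique (_∈ C) E → IsClique (_∈ grow C ws) E
    grow-clique C []       clique = clique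
    grow-clique C (w ∷ ws) clique with adjacentToAll? C w
    ... | yes adj = grow-clique (C ∪ ⁅ w ⁆) ws (insert-clique clique adj)
    ... | no  _   = grow-clique C ws clique

    grow-maximal : ∀ C ws → Any (w ≡_) ws → AdjacentToAll (grow C ws) w → w ∈ grow C ws
    grow-maximal {w} C (w′ ∷ ws) (Any.here refl) adj with adjacentToAll? C w
    ... | yes _   = grow-⊇ (C ∪ ⁅ w ⁆) ws (x∈p∪q⁺ (inj₂ (x∈⁅x⁆ w)))
    ... | no ¬adj = ⊥-elim (¬adj λ z zC → adj z (grow-⊇ C ws zC))
    grow-maximal C (w′ ∷ ws) (Any.there w∈) adj with adjacentToAll? C w′
    ... | yes _ = grow-maximal (C ∪ ⁅ w′ ⁆) ws w∈ adj
    ... | no  _ = grow-maximal C ws w∈ adj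

    clique⊆maxClique : ∀ {C} → IsClique (_∈ C) E → Σ (Subset n) λ K → MaxClique E K × C ⊆ K
    clique⊆maxClique {C} clique =
      grow C (allFin n) ,
      (grow-clique C (allFin n) clique , λ w → grow-maximal C (allFin n) (∈-allFin w)) ,
      grow-⊇ C (allFin n)

    edge-clique : E u v → IsClique (_∈ ⁅ u ⁆ ∪ ⁅ v ⁆) E
    edge-clique {u = u} {v = v} uv =
      insert-clique {C = ⁅ u ⁆} single (λ z zu z≢v → subst (λ t → E t v) (sym (x∈⁅y⁆⇒x≡y u zu)) uv)
      where
      single : IsClique (_∈ ⁅ u ⁆) E
      single a b au bu a≢b = ⊥-elim (a≢b (trans (x∈⁅y⁆⇒x≡y u au) (sym (x∈⁅y⁆⇒x≡y u bu))))

    edge⊆maxClique : E u v → Σ (Subset n) λ K → MaxClique E K × u ∈ K × v ∈ K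
    edge⊆maxClique {u = u} {v = v} uv with clique⊆maxClique (edge-clique uv)
    ... | K , maxK , ⊆K = K , maxK , ⊆K (x∈p∪q⁺ (inj₁ (x∈⁅x⁆ u))) , ⊆K (x∈p∪q⁺ (inj₂ (x∈⁅x⁆ v)))

  data Route (Q : Fin n → Set) (E : Rel n) : Fin n → Fin n → Set where
    edge : E u v → Route Q E u v
    via  : E u w → Q w → Route Q E w v → Route Q E u v

  joinʳ : Route Q E u w → Q w → Route Q E w v → Route Q E u v
  joinʳ (edge e)      qw r = via e qw r
  joinʳ (via e qm r′) qw r = via e qm (joinʳ r′ qw r)

  Near : Rel n → Fin n → Fin n → Set
  Near E u x = u ≡ x ⊎ E u x

  -- u ∷ ps are the vertices, in order, of an induced path of E from u to v
  data InducedList (E : Rel n) : Fin n → Fin n → List (Fin n) → Set where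
    stop : InducedList E v v []
    link : E u w → All (¬_ ∘ Near E u) ps → InducedList E w v ps → InducedList E u v (w ∷ ps)

  InducedPathVia : (Fin n → Set) → Rel n → Fin n → Fin n → Set
  InducedPathVia Q E u v =
    Σ ℕ λ k → Σ (Fin (suc k) → Fin n) λ p →
      InducedPath E k p × p zero ≡ u × p (fromℕ k) ≡ v × (∀ i → 0 < toℕ i → toℕ i < k → Q (p i))

  module _ (g : SimpleGraph E) where

    near? : ∀ u x → Dec (Near E u x)
    near? u x = (u ≟ x) ⊎-dec adjacent? g u x

    -- Prepend u to an induced path that u touches, cutting off everything before the last vertex
    -- that u touches.
    prepend : ∀ u → InducedList E w v ps → Any (Near E u) (w ∷ ps) → All R (w ∷ ps) →
              Σ (List (Fin n)) λ qs → InducedList E u v qs × All R qs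
    prepend {w = w} {ps = ps} u p touch (rw ∷ rs) with u ≟ w | Any.any? (near? u) ps
    ... | yes refl | _ = ps , p , rs
    prepend u (link _ _ p) _ (_ ∷ rs) | no _ | yes touch = prepend u p touch rs
    prepend {w = w} {ps = ps} u p touch (rw ∷ rs) | no u≢w | no ¬touch =
      w ∷ ps , link (touchHead touch) (¬Any⇒All¬ ps ¬touch) p , rw ∷ rs
      where
      touchHead : Any (Near E u) (w ∷ ps) → E u w
      touchHead (Any.here (inj₁ u≡w)) = ⊥-elim (u≢w u≡w)
      touchHead (Any.here (inj₂ uw))  = uw
      touchHead (Any.there touch)     = ⊥-elim (¬touch touch)

    route⇒inducedList : Route Q E u v → Σ (List (Fin n)) λ qs → InducedList E u v qs × All (λ x → Q x ⊎ x ≡ v) qs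
    route⇒inducedList (edge e)     = _ , link e [] stop , inj₂ refl ∷ []
    route⇒inducedList (via e qw r) with route⇒inducedList r
    ... | _ , p , rs = prepend _ p (Any.here (inj₂ e)) (inj₁ qw ∷ rs)

    inducedList⇒inducedPath : InducedList E u v ps → InducedPath E (length ps) (lookup (u ∷ ps))
    inducedList⇒inducedPath stop = record
      { distinct = λ { zero zero _ → refl }
      ; adj      = λ { zero zero uu → ⊥-elim (SimpleGraph.irrefl g uu) }
      ; adj'     = λ { zero zero (inj₁ ()) ; zero zero (inj₂ ()) }
      }
    inducedList⇒inducedPath {u = u} (link {w = w} {ps = ps} uw far p) = record
      { distinct = distinct ; adj = adj ; adj' = adj' }
      where
      open InducedPath (inducedList⇒inducedPath p)
        renaming (distinct to distinct₀; adj to adj₀; adj' to adj'₀)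
      q = lookup (u ∷ w ∷ ps)
      farFrom : ∀ j → ¬ Near E u (lookup ps j)
      farFrom j = All.lookup far (∈-lookup j)
      sym-E = SimpleGraph.sym g
      u≢w : u ≢ w
      u≢w refl = SimpleGraph.irrefl g uw

      distinct : ∀ i j → q i ≡ q j → i ≡ j
      distinct zero          zero          _  = refl
      distinct zero          (suc zero)    eq = ⊥-elim (u≢w eq)
      distinct zero          (suc (suc j)) eq = ⊥-elim (farFrom j (inj₁ eq))
      distinct (suc zero)    zero          eq = ⊥-elim (u≢w (sym eq))
      distinct (suc (suc i)) zero          eq = ⊥-elim (farFrom i (inj₁ (sym eq)))
      distinct (suc i)       (suc j)       eq = cong suc (distinct₀ i j eq)

      adj : ∀ i j → E (q i) (q j) → toℕ j ≡ suc (toℕ i) ⊎ toℕ i ≡ suc (toℕ j)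
      adj zero          zero          e = ⊥-elim (SimpleGraph.irrefl g e)
      adj zero          (suc zero)    _ = inj₁ refl
      adj zero          (suc (suc j)) e = ⊥-elim (farFrom j (inj₂ e))
      adj (suc zero)    zero          _ = inj₂ refl
      adj (suc (suc i)) zero          e = ⊥-elim (farFrom i (inj₂ (sym-E e)))
      adj (suc i)       (suc j)       e = Sum.map (cong suc) (cong suc) (adj₀ i j e)

      adj' : ∀ i j → toℕ j ≡ suc (toℕ i) ⊎ toℕ i ≡ suc (toℕ j) → E (q i) (q j)
      adj' zero          zero          (inj₁ ())
      adj' zero          zero          (inj₂ ())
      adj' zero          (suc zero)    _         = uw
      adj' zero          (suc (suc j)) (inj₁ ())
      adj' zero          (suc (suc j)) (inj₂ ())
      adj' (suc zero)    zero          _         = sym-E uw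
      adj' (suc (suc i)) zero          (inj₁ ())
      adj' (suc (suc i)) zero          (inj₂ ())
      adj' (suc i)       (suc j)       h         = adj'₀ i j (Sum.map ℕ.suc-injective ℕ.suc-injective h)

    inducedList-last : InducedList E u v ps → lookup (u ∷ ps) (fromℕ (length ps)) ≡ v
    inducedList-last stop         = refl
    inducedList-last (link _ _ p) = inducedList-last p

    -- Inner vertices differ from v since the path is induced, hence they satisfy Q.
    inducedList⇒inducedPathVia : InducedList E u v ps → All (λ x → Q x ⊎ x ≡ v) ps → InducedPathVia Q E u v
    inducedList⇒inducedPathVia {u = u} {ps = ps} {Q = Q} p rs =
      length ps , lookup (u ∷ ps) , path , refl , inducedList-last p , inner
      where
      path = inducedList⇒inducedPath p
      inner : ∀ i → 0 < toℕ i → toℕ i < length ps → Q (lookup (u ∷ ps) i)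
      inner (suc i) _ i<k with All.lookup rs (∈-lookup i)
      ... | inj₁ q   = q
      ... | inj₂ i≡v = ⊥-elim (ℕ.<-irrefl (trans (cong toℕ i≡last) (toℕ-fromℕ (length ps))) i<k)
        where
        i≡last : suc i ≡ fromℕ (length ps)
        i≡last = InducedPath.distinct path (suc i) _ (trans i≡v (sym (inducedList-last p)))

    route⇒inducedPathVia : Route Q E u v → InducedPathVia Q E u v
    route⇒inducedPathVia r with route⇒inducedList r
    ... | _ , p , rs = inducedList⇒inducedPathVia p rs

module ClosureRegions {n : ℕ} (E : Rel n) (simple : SimpleGraph E) (clawFree : ClawFree ⊤ E)
                      (H : Rel n) (closure : IsClosure ⊤ E H) where

  private variable
    K K′ : Subset n
    F : Rel n
    a b u v w x y : Fin n

  private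
    simpleH : SimpleGraph H
    simpleH = compSeq-simple simple (proj₁ closure)

    symH : Symmetric H
    symH = SimpleGraph.sym simpleH

    E⊆H : E u v → H u v
    E⊆H = compSeq-mono (proj₁ closure)

    walk⇒adjacentH : H y u → H y w → u ≢ w → Walk (Nbhd ⊤ H y) H u w → H u w
    walk⇒adjacentH yu yw = closed-walk⇒adjacent simpleH (compSeq-clawFree simple clawFree (proj₁ closure))
      (proj₂ closure) ∈⊤ (∈⊤ , yu) (∈⊤ , yw)

  commonNeighbour⇒∈region : Region H K → a ∈ K → b ∈ K → a ≢ b → H y a → H y b → y ∈ K
  commonNeighbour⇒∈region {K = K} {a = a} {b = b} {y = y} (clique , maximal) aK bK a≢b ya yb =
    maximal y adjacent
    where
    adjacent : ∀ u → u ∈ K → u ≢ y → H u y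
    adjacent u uK u≢y with u ≟ a | u ≟ b
    ... | yes refl | _        = symH ya
    ... | no _     | yes refl = symH yb
    ... | no u≢a   | no u≢b   = symH (walk⇒adjacentH (symH ya) au (≢-sym u≢y)
          (step (∈⊤ , symH ya) yb (step (∈⊤ , ab) (clique b u bK uK (≢-sym u≢b)) (here (∈⊤ , au)))))
      where
      ab = clique a b aK bK a≢b
      au = clique a u aK uK (≢-sym u≢a)

  region-unique : Region H K → Region H K′ → a ≢ b → a ∈ K → b ∈ K → a ∈ K′ → b ∈ K′ → K ≡ K′
  region-unique {a = a} {b = b} regionK regionK′ a≢b aK bK aK′ bK′ =
    ⊆-antisym (⊆region regionK regionK′ aK bK aK′ bK′) (⊆region regionK′ regionK aK′ bK′ aK bK)
    where
    ⊆region : Region H K → Region H K′ → a ∈ K → b ∈ K → a ∈ K′ → b ∈ K′ → K ⊆ K′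
    ⊆region (clique , _) regionK′ aK bK aK′ bK′ {y} yK with y ≟ a | y ≟ b
    ... | yes refl | _        = aK′
    ... | no _     | yes refl = bK′
    ... | no y≢a   | no y≢b   =
      commonNeighbour⇒∈region regionK′ aK′ bK′ a≢b (clique y a yK aK y≢a) (clique y b yK bK y≢b)

  edge⇒region : H u v → Σ (Subset n) λ K → Region H K × u ∈ K × v ∈ K
  edge⇒region = edge⊆maxClique simpleH

  Simplicial : Fin n → Set
  Simplicial x = ∀ a b → H x a → H x b → a ≢ b → H a b

  simplicial? : ∀ x → Dec (Simplicial x)
  simplicial? x = all? λ a → all? λ b →
    adjacent? simpleH x a →-dec (adjacent? simpleH x b →-dec (¬? (a ≟ b) →-dec adjacent? simpleH a b))

  connectedNbhd⇒simplicial : Connected (Nbhd ⊤ H x) H → Simplicial x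
  connectedNbhd⇒simplicial connected a b xa xb a≢b =
    walk⇒adjacentH xa xb a≢b (connected a b (∈⊤ , xa) (∈⊤ , xb))

  simplicial⇒interior : Region H K → x ∈ K → Simplicial x → Interior H x
  simplicial⇒interior {K = K} {x = x} regionK xK simplicial =
    K , regionK , xK , λ K′ regionK′ xK′ →
      ⊆-antisym (⊆region regionK′ regionK xK′ xK) (⊆region regionK regionK′ xK xK′)
    where
    ⊆region : ∀ {A B} → Region H A → Region H B → x ∈ A → x ∈ B → A ⊆ B
    ⊆region {B = K′} (cliqueK , _) (cliqueK′ , maximalK′) xK xK′ {w} wK with w ≟ x
    ... | yes refl = xK′
    ... | no w≢x   = maximalK′ w adjacent
      where
      xw = cliqueK x w xK wK (≢-sym w≢x)
      adjacent : ∀ z → z ∈ K′ → z ≢ w → H z w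
      adjacent z zK′ z≢w with z ≟ x
      ... | yes refl = xw
      ... | no z≢x   = simplicial z w (cliqueK′ x z xK′ zK′ (≢-sym z≢x)) xw z≢w

  interior⇒simplicial : Interior H x → Simplicial x
  interior⇒simplicial (K , (cliqueK , _) , _ , unique) a b xa xb a≢b
    with edge⇒region xa | edge⇒region xb
  ... | Ka , regionKa , xKa , aKa | Kb , regionKb , xKb , bKb =
    cliqueK a b (subst (a ∈_) (unique Ka regionKa xKa) aKa) (subst (b ∈_) (unique Kb regionKb xKb) bKb) a≢b

  frontier⇒¬interior : Frontier H v → ¬ Interior H v
  frontier⇒¬interior (K₁ , K₂ , region₁ , region₂ , K₁≢K₂ , vK₁ , vK₂) (_ , _ , _ , unique) =
    K₁≢K₂ (trans (unique K₁ region₁ vK₁) (sym (unique K₂ region₂ vK₂)))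

  region-nontrivial : Region H K → v ∈ K → H v a → Σ (Fin n) λ w → w ∈ K × w ≢ v
  region-nontrivial {K = K} {v = v} {a = a} (_ , maximal) vK va
    with any? (λ w → (w ∈? K) ×-dec ¬? (w ≟ v))
  ... | yes (w , wK , w≢v) = w , wK , w≢v
  ... | no ¬other = a , maximal a onlyV , λ { refl → SimpleGraph.irrefl simpleH va }
    where
    onlyV : ∀ z → z ∈ K → z ≢ a → H z a
    onlyV z zK _ with z ≟ v
    ... | yes refl = va
    ... | no z≢v   = ⊥-elim (¬other (z , zK , z≢v))

  -- A new edge v c comes from a centre x that lies in K and is an old neighbour of v.
  region-edge⇒edge : SimpleGraph F → CompSeq ⊤ F H → Region H K → v ∈ K → w ∈ K → H v w →
    Σ (Fin n) λ c → c ∈ K × F v c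
  region-edge⇒edge {w = w} g done _ _ wK vw = w , wK , vw
  region-edge⇒edge g cs@(next x _ cs′) regionK vK wK vw
    with region-edge⇒edge (completeAt-simple g) cs′ regionK vK wK vw
  ... | c , cK , inj₁ vc = c , cK , vc
  ... | c , cK , inj₂ (v≢c , (_ , xv) , (_ , xc)) =
    x , commonNeighbour⇒∈region regionK vK cK v≢c (compSeq-mono cs xv) (compSeq-mono cs xc) ,
    SimpleGraph.sym g xv

  frontier-nbhd-clique : Region H K → Region H K′ → K ≢ K′ → v ∈ K → v ∈ K′ → IsClique (Nbhd K E v) E
  frontier-nbhd-clique {K = K} {K′ = K′} {v = v} regionK regionK′ K≢K′ vK vK′ a b (aK , va) (bK , vb) a≢b
    with adjacent? simple a b
  ... | yes ab = ab
  ... | no ¬ab = ⊥-elim (noClaw (neighbourIn (region-nontrivial regionK′ vK′ (E⊆H va))))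
    where
    neighbourIn : Σ (Fin n) (λ w → w ∈ K′ × w ≢ v) → Σ (Fin n) λ c → c ∈ K′ × E v c
    neighbourIn (w , wK′ , w≢v) =
      region-edge⇒edge simple (proj₁ closure) regionK′ vK′ wK′ (proj₁ regionK′ v w vK′ wK′ (≢-sym w≢v))

    notInK′ : ∀ {t} → t ∈ K → E v t → t ∈ K′ → ⊥
    notInK′ tK vt tK′ =
      K≢K′ (region-unique regionK regionK′ (λ { refl → SimpleGraph.irrefl simple vt }) vK tK vK′ tK′)

    noClaw : Σ (Fin n) (λ c → c ∈ K′ × E v c) → ⊥
    noClaw (c , cK′ , vc) =
      clawFree v a b c ∈⊤ ∈⊤ ∈⊤ ∈⊤ va vb vc a≢b (≢c aK va) (≢c bK vb) ¬ab (¬c aK va) (¬c bK vb)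
      where
      ≢c : ∀ {t} → t ∈ K → E v t → t ≢ c
      ≢c tK vt refl = notInK′ tK vt cK′
      ¬c : ∀ {t} → t ∈ K → E v t → ¬ E t c
      ¬c tK vt tc = notInK′ tK vt (commonNeighbour⇒∈region regionK′ vK′ cK′
        (λ { refl → SimpleGraph.irrefl simple vc }) (symH (E⊆H vt)) (E⊆H tc))

  module _ {K : Subset n} (regionK : Region H K) {H′ : Rel n} (closure′ : IsClosure K E H′) where

    private
      clawFreeK : ClawFree K E
      clawFreeK x a b c _ _ _ _ = clawFree x a b c ∈⊤ ∈⊤ ∈⊤ ∈⊤

      walk⇒adjacentH′ : x ∈ K → Nbhd K H′ x u → Nbhd K H′ x w → u ≢ w → Walk (Nbhd K H′ x) H′ u w → H′ u w
      walk⇒adjacentH′ = closed-walk⇒adjacent (compSeq-simple simple (proj₁ closure′))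
        (compSeq-clawFree simple clawFreeK (proj₁ closure′)) (proj₂ closure′)

    -- A new edge a b of a completion at x has x ∈ K; the walk joining a and b in N_F(x) stays in K,
    -- so it becomes a walk of H′ in N_K(x), and closedness of H′ makes a b an edge.
    region-edge⇒closureEdge : SimpleGraph F → CompSeq ⊤ F H →
      (∀ {a b} → a ∈ K → b ∈ K → F a b → H′ a b) → a ∈ K → b ∈ K → H a b → H′ a b
    region-edge⇒closureEdge g done old = old
    region-edge⇒closureEdge {F = F} g cs@(next x (_ , connected , _) cs′) old =
      region-edge⇒closureEdge (completeAt-simple g) cs′ new
      where
      new : ∀ {a b} → a ∈ K → b ∈ K → completeAt ⊤ F x a b → H′ a b
      new aK bK (inj₁ ab) = old aK bK ab
      new {a} {b} aK bK (inj₂ (a≢b , (_ , xa) , (_ , xb))) =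
        walk⇒adjacentH′ xK (aK , old xK aK xa) (bK , old xK bK xb) a≢b
          (inRegion aK (connected a b (∈⊤ , xa) (∈⊤ , xb)))
        where
        xK : x ∈ K
        xK = commonNeighbour⇒∈region regionK aK bK a≢b (compSeq-mono cs xa) (compSeq-mono cs xb)

        inRegion : ∀ {s t} → s ∈ K → Walk (Nbhd ⊤ F x) F s t → Walk (Nbhd K H′ x) H′ s t
        inRegion sK (here (_ , xs))      = here (sK , old xK sK xs)
        inRegion sK (step (_ , xs) st p) = step (sK , old xK sK xs) (old sK tK st) (inRegion tK p)
          where
          x≢s = λ { refl → SimpleGraph.irrefl g xs }
          tK = commonNeighbour⇒∈region regionK xK sK x≢s
                 (symH (compSeq-mono cs (proj₂ (walk-head p)))) (symH (compSeq-mono cs st))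

    region-closure-complete : IsClique (_∈ K) H′
    region-closure-complete u v uK vK u≢v =
      region-edge⇒closureEdge simple (proj₁ closure) (λ _ _ → compSeq-mono (proj₁ closure′))
        uK vK (proj₁ regionK u v uK vK u≢v)

  InteriorIn : Subset n → Fin n → Set
  InteriorIn K x = x ∈ K × Interior H x

  -- The centre of a completion creating an edge inside K lies in K and becomes simplicial in H.
  region-edge⇒route : Region H K → SimpleGraph F → CompSeq ⊤ F H →
    (∀ {a b} → a ∈ K → b ∈ K → F a b → Route (InteriorIn K) E a b) →
    a ∈ K → b ∈ K → H a b → Route (InteriorIn K) E a b
  region-edge⇒route regionK g done old = old
  region-edge⇒route {K = K} {F = F} regionK g cs@(next x (_ , connected , _) cs′) old =
    region-edge⇒route regionK (completeAt-simple g) cs′ new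
    where
    new : ∀ {a b} → a ∈ K → b ∈ K → completeAt ⊤ F x a b → Route (InteriorIn K) E a b
    new aK bK (inj₁ ab) = old aK bK ab
    new aK bK (inj₂ (a≢b , (_ , xa) , (_ , xb))) =
      joinʳ (old aK xK (SimpleGraph.sym g xa)) (xK , interiorX) (old xK bK xb)
      where
      xK = commonNeighbour⇒∈region regionK aK bK a≢b (compSeq-mono cs xa) (compSeq-mono cs xb)
      interiorX = simplicial⇒interior regionK xK
        (connectedNbhd⇒simplicial (compSeq-connectedNbhd g cs connected))

  region-route : Region H K → a ∈ K → b ∈ K → a ≢ b → Route (InteriorIn K) E a b
  region-route {a = a} {b = b} regionK aK bK a≢b =
    region-edge⇒route regionK simple (proj₁ closure) (λ _ _ → edge) aK bK (proj₁ regionK a b aK bK a≢b)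

  frontier-region-dichotomy : Frontier H v → Region H K → v ∈ K →
    (Σ (Fin n) λ u → u ∈ K × E v u × Interior H u) ⊎ (IsClique (_∈ K) E × (∀ u → u ∈ K → ¬ Interior H u))
  frontier-region-dichotomy {v = v} {K = K} frontier regionK vK
    with any? (λ u → (u ∈? K) ×-dec ¬? (u ≟ v) ×-dec simplicial? u)
  ... | yes (u , uK , u≢v , simplicialU) = inj₁ (firstStep (region-route regionK vK uK (≢-sym u≢v)))
    where
    firstStep : Route (InteriorIn K) E v u → Σ (Fin n) λ w → w ∈ K × E v w × Interior H w
    firstStep (edge vu)                   = u , uK , vu , simplicial⇒interior regionK uK simplicialU
    firstStep (via vw (wK , interiorW) _) = _ , wK , vw , interiorW
  ... | no ¬simplicial = inj₂ (clique , noInterior)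
    where
    noInterior : ∀ u → u ∈ K → ¬ Interior H u
    noInterior u uK interiorU with u ≟ v
    ... | yes refl = frontier⇒¬interior frontier interiorU
    ... | no u≢v   = ¬simplicial (u , uK , u≢v , interior⇒simplicial interiorU)

    clique : IsClique (_∈ K) E
    clique a b aK bK a≢b with region-route regionK aK bK a≢b
    ... | edge ab                  = ab
    ... | via _ (wK , interiorW) _ = ⊥-elim (noInterior _ wK interiorW)

  region-inducedPath : Region H K → u ∈ K → v ∈ K → InducedPathVia (InteriorIn K) E u v
  region-inducedPath {K = K} {u = u} {v = v} regionK uK vK with u ≟ v
  ... | yes refl = inducedList⇒inducedPathVia simple {Q = InteriorIn K} stop []
  ... | no u≢v   = route⇒inducedPathVia simple (region-route regionK uK vK u≢v)

lemma3 : ∀ {n : ℕ} (E : Rel n) → SimpleGraph E → ClawFree ⊤ E →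
    (H : Rel n) → IsClosure ⊤ E H →
    (∀ v K K' → Region H K → Region H K' → K ≢ K' → v ∈ K → v ∈ K' →
      IsClique (λ u → Nbhd K E v u) E × IsClique (λ u → Nbhd K' E v u) E)
    × (∀ K → Region H K → (H' : Rel n) → IsClosure K E H' → IsClique (_∈ K) H')
    × (∀ v K → Frontier H v → Region H K → v ∈ K →
      (Σ (Fin n) λ u → u ∈ K × E v u × Interior H u)
      ⊎ (IsClique (_∈ K) E × (∀ u → u ∈ K → ¬ Interior H u)))
    × (∀ u v K → Region H K → u ∈ K → v ∈ K →
      Σ ℕ λ k → Σ (Fin (suc k) → Fin n) λ p →
        InducedPath E k p × p zero ≡ u × p (fromℕ k) ≡ v ×
        (∀ i → 0 < toℕ i → toℕ i < k →
          p i ∈ K × Interior H (p i)))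
lemma3 E simple clawFree H closure =
  (λ v K K′ regionK regionK′ K≢K′ vK vK′ →
     frontier-nbhd-clique regionK regionK′ K≢K′ vK vK′ ,
     frontier-nbhd-clique regionK′ regionK (≢-sym K≢K′) vK′ vK) ,
  (λ K regionK H′ closure′ → region-closure-complete regionK closure′) ,
  (λ v K frontier regionK vK → frontier-region-dichotomy frontier regionK vK) ,
  (λ u v K regionK uK vK → region-inducedPath regionK uK vK)
  where open ClosureRegions E simple clawFree H closure
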